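{- Let $d\geqslant 3$ be an integer. For all positive integers $w,z\geqslant 3^d$, we have $p_{A_d}(w)\,p_{A_d}(z)>p_{A_d}(w+z)$. If $d=2$, the inequality $p_{A_2}(w)\,p_{A_2}(z)>p_{A_2}(w+z)$ holds for all integers $w,z\geqslant 12$.
   Context: For an integer $d\geqslant2$, let $A_d=\{n^d:n\in\mathbb{N}_+\}$. The $d$-th power partition function $p_{A_d}(n)$ is the number of partitions of $n$ all of whose parts are perfect $d$-th powers of positive integers. -}

module Defs where

open import Data.Nat using (ℕ; zero; suc; _+_; _∸_; _^_; _≤ᵇ_)
open import Data.Bool using (if_then_else_)

-- cnt d f k n : number of partitions of n into parts from { j ^ d : 1 ≤ j ≤ k },
-- i.e. multisets of bases j ∈ {1..k} with Σ j^d = n.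
-- The fuel argument f only ensures structural termination; it is adequate
-- whenever f ≥ n (each removed part is ≥ 1), and we always call it with f = n.
cnt : ℕ → ℕ → ℕ → ℕ → ℕ
cnt d f       zero    zero    = 1
cnt d f       zero    (suc n) = 0
cnt d zero    (suc k) n       = cnt d zero k n
cnt d (suc f) (suc k) n       =
  cnt d (suc f) k n +
  (if (suc k ^ d) ≤ᵇ n then cnt d f (suc k) (n ∸ (suc k ^ d)) else 0)

-- p_{A_d}(n): number of partitions of n whose parts are all d-th powers of
-- positive integers.  Any such part j^d ≤ n forces j ≤ n, so bases up to n suffice.
pA : ℕ → ℕ → ℕ
pA d n = cnt d n n n

-- Write p for p_{A_d}, u = 2^d, and r n for the number of partitions of n into d-th powers
-- with no part u, so that p n = r n + p (n ∸ u).  Fix 3u, 3^d ≤ w ≤ z and F = p w ∸ 1.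
-- Peeling the parts u off z gives p (w + z) + 1 ≤ F · p z + p (w ∸ 1) ≤ p w · p z as soon as
-- r (w + y) ≤ F · r y for all y, strictly for y < u.  That bound follows by induction on the
-- largest base j, splitting off one part j^d: parts with j^d ≤ y are handled by induction on y,
-- and the remaining contributions come from the bases with y < j^d ≤ w + y.  Those bases form a
-- run a, a+1, …, a+t; since (a+i)^d ≥ a^d + i·2^d, the i-th of them leaves at most w ∸ i·u, so
-- together they are dominated by the sum of r (w ∸ i·u) over i ≤ t, which is
-- p w ∸ p (w ∸ (t+1)·u), and the run is short enough ((t+2)·u ≤ w) that p (w ∸ (t+1)·u) ≥ 2.

module Submission where

open import Defs
open import Data.Bool using (Bool; true; false; not; if_then_else_)
open import Data.Empty using (⊥-elim)
open import Data.Nat using (ℕ; zero; suc; _+_; _*_; _^_; _∸_; _≤_; _<_; z≤n; s≤s; _≤ᵇ_; _≡ᵇ_; _≤?_; _<?_)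
open import Data.Nat.Induction using (<-rec)
open import Data.Nat.Properties
open import Data.Nat.Solver using (module +-*-Solver)
open import Data.Product using (_×_; _,_; proj₁)
open import Data.Sum using (inj₁; inj₂)
open import Data.Unit using (tt)
open import Relation.Binary.PropositionalEquality
open import Relation.Nullary using (Dec; yes; no; does; ¬_)
open import Relation.Nullary.Decidable using (dec-true; dec-false; _×-dec_)

open +-*-Solver
open import Algebra.Properties.CommutativeSemigroup +-commutativeSemigroup using (interchange; xy∙z≈xz∙y)

m≤m^n : ∀ m {n} → 1 ≤ n → m ≤ m ^ n
m≤m^n zero            _ = z≤n
m≤m^n m@(suc _) {suc n} _ = m≤m*n m (m ^ n) {{m^n≢0 m n}}

m≤1+n⇒m∸o≤n : ∀ {m n o} → 0 < o → m ≤ suc n → m ∸ o ≤ n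
m≤1+n⇒m∸o≤n {m} {n} {o} 0<o m≤1+n = m≤n+o⇒m∸n≤o m o (≤-trans m≤1+n (+-monoˡ-≤ n 0<o))

m+n∸o≤m∸k : ∀ m {n o k} → k + n ≤ o → m + n ∸ o ≤ m ∸ k
m+n∸o≤m∸k m {n} {o} {k} k+n≤o = begin
  m + n ∸ o        ≤⟨ ∸-monoʳ-≤ (m + n) k+n≤o ⟩
  m + n ∸ (k + n)  ≡⟨ cong₂ _∸_ (+-comm m n) (+-comm k n) ⟩
  n + m ∸ (n + k)  ≡⟨ [m+n]∸[m+o]≡n∸o n m k ⟩
  m ∸ k            ∎
  where open ≤-Reasoning

-- Phrased with _≤ᵇ_ so that it is literally the summand of Defs.cnt.
shift : ℕ → (ℕ → ℕ) → ℕ → ℕ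
shift K g n = if K ≤ᵇ n then g (n ∸ K) else 0

shift-≥ : ∀ {K n} g → K ≤ n → shift K g n ≡ g (n ∸ K)
shift-≥ {K} {n} g K≤n with K ≤ᵇ n | ≤⇒≤ᵇ K≤n
... | true | _ = refl

shift-< : ∀ {K n} g → n < K → shift K g n ≡ 0
shift-< {K} {n} g n<K with K ≤ᵇ n | ≤ᵇ⇒≤ K n
... | false | _ = refl
... | true | K≤n = ⊥-elim (<⇒≱ n<K (K≤n tt))

shift-cong : ∀ K {n} g h → (K ≤ n → g (n ∸ K) ≡ h (n ∸ K)) → shift K g n ≡ shift K h n
shift-cong K {n} g h eq with K ≤ᵇ n | ≤ᵇ⇒≤ K n
... | false | _ = refl
... | true | K≤n = eq (K≤n tt)

shift-comm : ∀ {a b n} g → a ≤ n → b ≤ n → shift a g (n ∸ b) ≡ shift b g (n ∸ a)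
shift-comm {a} {b} {n} g a≤n b≤n with a + b ≤? n
... | yes a+b≤n = begin
  shift a g (n ∸ b) ≡⟨ shift-≥ g (m+n≤o⇒m≤o∸n a a+b≤n) ⟩
  g (n ∸ b ∸ a)     ≡⟨ cong g (∸-+-assoc n b a) ⟩
  g (n ∸ (b + a))   ≡⟨ cong (λ x → g (n ∸ x)) (+-comm b a) ⟩
  g (n ∸ (a + b))   ≡⟨ cong g (∸-+-assoc n a b) ⟨
  g (n ∸ a ∸ b)     ≡⟨ shift-≥ g (m+n≤o⇒m≤o∸n b (subst (_≤ n) (+-comm a b) a+b≤n)) ⟨
  shift b g (n ∸ a) ∎
  where open ≡-Reasoning
... | no a+b≰n =
  trans (shift-< g (overshoot a b b≤n n<a+b))
        (sym (shift-< g (overshoot b a a≤n (subst (n <_) (+-comm a b) n<a+b))))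
  where
  n<a+b : n < a + b
  n<a+b = ≰⇒> a+b≰n
  overshoot : ∀ x y → y ≤ n → n < x + y → n ∸ y < x
  overshoot x y y≤n n<x+y = subst (n ∸ y <_) (m+n∸n≡m x y) (∸-monoˡ-< n<x+y y≤n)

shift-suc-mono : ∀ K {n} g → (K ≤ n → g (n ∸ K) ≤ g (suc (n ∸ K))) → shift K g n ≤ shift K g (suc n)
shift-suc-mono K {n} g step with K ≤? n
... | yes K≤n = subst₂ _≤_ (sym (shift-≥ g K≤n))
                          (sym (trans (shift-≥ g (≤-trans K≤n (n≤1+n n))) (cong g (+-∸-assoc 1 K≤n))))
                          (step K≤n)
... | no  K≰n = subst (_≤ shift K g (suc n)) (sym (shift-< g (≰⇒> K≰n))) z≤n

when : Bool → ℕ → ℕ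
when true  x = x
when false _ = 0

when-mono : ∀ b {x y} → x ≤ y → when b x ≤ when b y
when-mono true  x≤y = x≤y
when-mono false _   = ≤-refl

when-0 : ∀ b {x} → x ≡ 0 → when b x ≡ 0
when-0 true  x≡0 = x≡0
when-0 false _   = refl

power-gap-step : ∀ {a t n} c → 2 ≤ a → a ^ n + c * 2 ^ n ≤ (a + t) ^ n →
                 a ^ suc n + c * 2 ^ suc n ≤ (a + t) ^ suc n
power-gap-step {a} {t} {n} c 2≤a gap = begin
  a * a ^ n + c * (2 * 2 ^ n) ≡⟨ cong (a * a ^ n +_) (x*[2*y]≡2*[x*y] c (2 ^ n)) ⟩
  a * a ^ n + 2 * (c * 2 ^ n) ≤⟨ +-monoʳ-≤ (a * a ^ n) (*-monoˡ-≤ (c * 2 ^ n) 2≤a) ⟩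
  a * a ^ n + a * (c * 2 ^ n) ≡⟨ *-distribˡ-+ a (a ^ n) (c * 2 ^ n) ⟨
  a * (a ^ n + c * 2 ^ n)     ≤⟨ *-monoʳ-≤ a gap ⟩
  a * (a + t) ^ n             ≤⟨ *-monoˡ-≤ ((a + t) ^ n) (m≤m+n a t) ⟩
  (a + t) * (a + t) ^ n       ∎
  where
  open ≤-Reasoning
  x*[2*y]≡2*[x*y] : ∀ x y → x * (2 * y) ≡ 2 * (x * y)
  x*[2*y]≡2*[x*y] = solve 2 (λ x y → x :* (con 2 :* y) := con 2 :* (x :* y)) refl

power-gap : ∀ e {a} t → 2 ≤ a → a ^ (2 + e) + t * 2 ^ (2 + e) ≤ (a + t) ^ (2 + e)
power-gap zero t (s≤s (s≤s (z≤n {n = a}))) =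
  subst ((2 + a) ^ 2 + t * 2 ^ 2 ≤_) (sym (square a t)) (m≤m+n _ (2 * a * t + t * t))
  where
  square : ∀ a t → (2 + a + t) ^ 2 ≡ (2 + a) ^ 2 + t * 2 ^ 2 + (2 * a * t + t * t)
  square = solve 2 (λ a t → (con 2 :+ a :+ t) :^ 2
                          := (con 2 :+ a) :^ 2 :+ t :* con 2 :^ 2 :+ (con 2 :* a :* t :+ t :* t)) refl
power-gap (suc e) t 2≤a = power-gap-step {t = t} {n = 2 + e} t 2≤a (power-gap e t 2≤a)

power-gap-wide : ∀ e {a t} → 3 ≤ a → 2 ≤ t → a ^ (2 + e) + (t + 2) * 2 ^ (2 + e) ≤ (a + t) ^ (2 + e)
power-gap-wide zero (s≤s (s≤s (s≤s (z≤n {n = a})))) (s≤s (s≤s (z≤n {n = t}))) =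
  subst ((3 + a) ^ 2 + (2 + t + 2) * 2 ^ 2 ≤_) (sym (square a t)) (m≤m+n _ (6 * t + 4 * a + 2 * a * t + t * t))
  where
  square : ∀ a t → (3 + a + (2 + t)) ^ 2
                 ≡ (3 + a) ^ 2 + (2 + t + 2) * 2 ^ 2 + (6 * t + 4 * a + 2 * a * t + t * t)
  square = solve 2 (λ a t → (con 3 :+ a :+ (con 2 :+ t)) :^ 2
                          := (con 3 :+ a) :^ 2 :+ (con 2 :+ t :+ con 2) :* con 2 :^ 2
                             :+ (con 6 :* t :+ con 4 :* a :+ con 2 :* a :* t :+ t :* t)) refl
power-gap-wide (suc e) {t = t} 3≤a 2≤t =
  power-gap-step {t = t} {n = 2 + e} (t + 2) (≤-trans (n≤1+n 2) 3≤a) (power-gap-wide e 3≤a 2≤t)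

scaled-2^≤3^ : ∀ c k e → c * 2 ^ k ≤ 3 ^ k → c * 2 ^ (k + e) ≤ 3 ^ (k + e)
scaled-2^≤3^ c k e base = begin
  c * 2 ^ (k + e)       ≡⟨ cong (c *_) (^-distribˡ-+-* 2 k e) ⟩
  c * (2 ^ k * 2 ^ e)   ≡⟨ *-assoc c (2 ^ k) (2 ^ e) ⟨
  c * 2 ^ k * 2 ^ e     ≤⟨ *-mono-≤ base (^-monoˡ-≤ e (n≤1+n 2)) ⟩
  3 ^ k * 3 ^ e         ≡⟨ ^-distribˡ-+-* 3 k e ⟨
  3 ^ (k + e)           ∎
  where open ≤-Reasoning

-- count k n: partitions of n into parts j ^ d with 1 ≤ j ≤ k and allowed j.
module PowerPartitions (d : ℕ) (allowed : ℕ → Bool) where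

  countWithFuel : ℕ → ℕ → ℕ → ℕ
  countWithFuel f       zero    zero    = 1
  countWithFuel f       zero    (suc n) = 0
  countWithFuel zero    (suc k) n       = countWithFuel zero k n
  countWithFuel (suc f) (suc k) n       =
    countWithFuel (suc f) k n + when (allowed (suc k)) (shift (suc k ^ d) (countWithFuel f (suc k)) n)

  count : ℕ → ℕ → ℕ
  count k n = countWithFuel n k n

  total : ℕ → ℕ
  total n = count n n

  0<base^d : ∀ k → 0 < suc k ^ d
  0<base^d k = m^n>0 (suc k) d

  guarded-shift-at-0 : ∀ k g → when (allowed (suc k)) (shift (suc k ^ d) g 0) ≡ 0
  guarded-shift-at-0 k g = when-0 (allowed (suc k)) (shift-< g (0<base^d k))

  fuel-irrelevant-at-0 : ∀ g k → countWithFuel 0 k 0 ≡ countWithFuel g k 0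
  fuel-irrelevant-at-0 g       zero    = refl
  fuel-irrelevant-at-0 zero    (suc k) = refl
  fuel-irrelevant-at-0 (suc g) (suc k) =
    trans (fuel-irrelevant-at-0 (suc g) k)
          (sym (trans (cong (countWithFuel (suc g) k 0 +_) (guarded-shift-at-0 k (countWithFuel g (suc k))))
                      (+-identityʳ _)))

  fuel-irrelevant : ∀ f g k n → n ≤ f → n ≤ g → countWithFuel f k n ≡ countWithFuel g k n
  fuel-irrelevant f       g       zero    zero    _   _   = refl
  fuel-irrelevant f       g       zero    (suc n) _   _   = refl
  fuel-irrelevant zero    g       (suc k) zero    _   _   = fuel-irrelevant-at-0 g (suc k)
  fuel-irrelevant (suc f) zero    (suc k) zero    _   _   = sym (fuel-irrelevant-at-0 (suc f) (suc k))
  fuel-irrelevant (suc f) (suc g) (suc k) n       n≤f n≤g =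
    cong₂ _+_ (fuel-irrelevant (suc f) (suc g) k n n≤f n≤g)
              (cong (when (allowed (suc k))) (shift-cong (suc k ^ d) (countWithFuel f (suc k)) (countWithFuel g (suc k))
                λ _ → fuel-irrelevant f g (suc k) _ (fuel-drop n≤f) (fuel-drop n≤g)))
    where
    fuel-drop : ∀ {h} → n ≤ suc h → n ∸ suc k ^ d ≤ h
    fuel-drop = m≤1+n⇒m∸o≤n (0<base^d k)

  count-suc : ∀ k n → count (suc k) n ≡ count k n + when (allowed (suc k)) (shift (suc k ^ d) (count (suc k)) n)
  count-suc k zero    = sym (trans (cong (count k 0 +_) (guarded-shift-at-0 k (count (suc k)))) (+-identityʳ _))
  count-suc k (suc n) =
    cong (count k (suc n) +_) (cong (when (allowed (suc k)))
      (shift-cong (suc k ^ d) (countWithFuel n (suc k)) (count (suc k)) λ _ →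
        fuel-irrelevant n _ (suc k) _ (m≤1+n⇒m∸o≤n (0<base^d k) ≤-refl) ≤-refl))

  count-stable : ∀ k n → n < suc k ^ d → count (suc k) n ≡ count k n
  count-stable k n n<K =
    trans (count-suc k n) (trans (cong (count k n +_) (when-0 (allowed (suc k)) (shift-< (count (suc k)) n<K)))
                                 (+-identityʳ _))

  count-saturated : 1 ≤ d → ∀ {k n} → n ≤ k → count k n ≡ total n
  count-saturated 1≤d {k} n≤k with m≤n⇒m<n∨m≡n n≤k
  ... | inj₂ refl = refl
  count-saturated 1≤d {suc k} {n} _ | inj₁ (s≤s n≤k) =
    trans (count-stable k n (≤-trans (s≤s n≤k) (m≤m^n (suc k) 1≤d))) (count-saturated 1≤d n≤k)

  count-monoˡ : ∀ {j k} n → j ≤ k → count j n ≤ count k n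
  count-monoˡ {j} {k} n j≤k with m≤n⇒m<n∨m≡n j≤k
  ... | inj₂ refl = ≤-refl
  count-monoˡ {j} {suc k} n _ | inj₁ (s≤s j≤k) =
    ≤-trans (count-monoˡ n j≤k) (subst (count k n ≤_) (sym (count-suc k n)) (m≤m+n _ _))

  count≤total : 1 ≤ d → ∀ k n → count k n ≤ total n
  count≤total 1≤d k n with ≤-total k n
  ... | inj₁ k≤n = count-monoˡ n k≤n
  ... | inj₂ n≤k = ≤-reflexive (count-saturated 1≤d n≤k)

  module _ (1-allowed : allowed 1 ≡ true) where

    count-1 : ∀ n → count 1 n ≡ 1
    count-1 zero    = trans (count-suc 0 0) (cong (1 +_) (guarded-shift-at-0 0 (count 1)))
    count-1 (suc n) = begin
      count 1 (suc n)                      ≡⟨ count-suc 0 (suc n) ⟩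
      when (allowed 1) (shift 1ᵈ (count 1) (suc n)) ≡⟨ cong (λ b → when b (shift 1ᵈ (count 1) (suc n))) 1-allowed ⟩
      shift 1ᵈ (count 1) (suc n)           ≡⟨ shift-≥ (count 1) (subst (_≤ suc n) (sym (^-zeroˡ d)) (s≤s z≤n)) ⟩
      count 1 (suc n ∸ 1ᵈ)                 ≡⟨ cong (λ K → count 1 (suc n ∸ K)) (^-zeroˡ d) ⟩
      count 1 n                            ≡⟨ count-1 n ⟩
      1                                    ∎
      where
      open ≡-Reasoning
      1ᵈ = 1 ^ d

    count-pos : ∀ k n → 1 ≤ count (suc k) n
    count-pos k n = subst (_≤ count (suc k) n) (count-1 n) (count-monoˡ n (s≤s z≤n))

    total-pos : 1 ≤ d → ∀ n → 1 ≤ total n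
    total-pos 1≤d n = ≤-trans (count-pos 0 n) (count≤total 1≤d 1 n)

    count-suc-monoʳ : ∀ n k → count (suc k) n ≤ count (suc k) (suc n)
    count-suc-monoʳ = <-rec _ step
      where
      step : ∀ n → (∀ {m} → m < n → ∀ k → count (suc k) m ≤ count (suc k) (suc m)) →
             ∀ k → count (suc k) n ≤ count (suc k) (suc n)
      step n rec zero    = ≤-reflexive (trans (count-1 n) (sym (count-1 (suc n))))
      step n rec (suc k) =
        subst₂ _≤_ (sym (count-suc (suc k) n)) (sym (count-suc (suc k) (suc n)))
          (+-mono-≤ (step n rec k) (when-mono (allowed (2 + k))
            (shift-suc-mono ((2 + k) ^ d) (count (2 + k)) λ K≤n →
              rec (∸-monoʳ-< (0<base^d (suc k)) K≤n) (suc k))))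

    count-monoʳ : ∀ k {m n} → m ≤ n → count (suc k) m ≤ count (suc k) n
    count-monoʳ k {m} {n} m≤n with m≤n⇒m<n∨m≡n m≤n
    ... | inj₂ refl = ≤-refl
    count-monoʳ k {m} {suc n} _ | inj₁ (s≤s m≤n) = ≤-trans (count-monoʳ k m≤n) (count-suc-monoʳ n k)

    total-mono : 1 ≤ d → ∀ {m n} → m ≤ n → total m ≤ total n
    total-mono 1≤d {m} {n} m≤n = begin
      total m           ≡⟨ count-saturated 1≤d (≤-trans m≤n (n≤1+n n)) ⟨
      count (suc n) m   ≤⟨ count-monoʳ n m≤n ⟩
      count (suc n) n   ≡⟨ count-saturated 1≤d (n≤1+n n) ⟩
      total n           ∎
      where open ≤-Reasoning

any-base : ℕ → Bool
any-base _ = true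

base≢2 : ℕ → Bool
base≢2 j = not (j ≡ᵇ 2)

cnt≡countWithFuel : ∀ d f k n → cnt d f k n ≡ PowerPartitions.countWithFuel d any-base f k n
cnt≡countWithFuel d f       zero    zero    = refl
cnt≡countWithFuel d f       zero    (suc n) = refl
cnt≡countWithFuel d zero    (suc k) n       = cnt≡countWithFuel d zero k n
cnt≡countWithFuel d (suc f) (suc k) n       =
  cong₂ _+_ (cnt≡countWithFuel d (suc f) k n)
            (shift-cong (suc k ^ d) (cnt d f (suc k)) (PowerPartitions.countWithFuel d any-base f (suc k))
              λ _ → cnt≡countWithFuel d f (suc k) _)

pA≡total : ∀ d n → pA d n ≡ PowerPartitions.total d any-base n
pA≡total d n = cnt≡countWithFuel d n n n

module SplitOffBaseTwo (d : ℕ) where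

  module C = PowerPartitions d any-base
  module R = PowerPartitions d base≢2

  u : ℕ
  u = 2 ^ d

  R-count-2 : ∀ n → R.count 2 n ≡ 1
  R-count-2 n = trans (R.count-suc 1 n) (trans (+-identityʳ _) (R.count-1 refl n))

  Splits : ℕ → ℕ → Set
  Splits k n = C.count (2 + k) n ≡ R.count (2 + k) n + shift u (C.count (2 + k)) n

  count-split : ∀ n k → Splits k n
  count-split = <-rec _ step
    where
    step : ∀ n → (∀ {m} → m < n → ∀ k → Splits k m) → ∀ k → Splits k n
    step n rec zero = begin
      C.count 2 n                          ≡⟨ C.count-suc 1 n ⟩
      C.count 1 n + shift u (C.count 2) n  ≡⟨ cong (_+ shift u (C.count 2) n) (C.count-1 refl n) ⟩
      1 + shift u (C.count 2) n            ≡⟨ cong (_+ shift u (C.count 2) n) (R-count-2 n) ⟨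
      R.count 2 n + shift u (C.count 2) n  ∎
      where open ≡-Reasoning
    step n rec (suc k) with (3 + k) ^ d ≤? n
    ... | no K≰n = begin
      C₃ n                 ≡⟨ C.count-stable (2 + k) n n<K ⟩
      C₂ n                 ≡⟨ step n rec k ⟩
      R₂ n + shift u C₂ n  ≡⟨ cong₂ _+_ (R.count-stable (2 + k) n n<K) (shift-cong u C₃ C₂
                                λ _ → C.count-stable (2 + k) (n ∸ u) (≤-<-trans (m∸n≤m n u) n<K)) ⟨
      R₃ n + shift u C₃ n  ∎
      where
      open ≡-Reasoning
      n<K = ≰⇒> K≰n
      C₂ = C.count (2 + k)
      C₃ = C.count (3 + k)
      R₂ = R.count (2 + k)
      R₃ = R.count (3 + k)
    ... | yes K≤n = begin
      C₃ n                                                 ≡⟨ C.count-suc (2 + k) n ⟩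
      C₂ n + shift K C₃ n                                  ≡⟨ cong₂ _+_ (step n rec k) (shift-≥ C₃ K≤n) ⟩
      (R₂ n + shift u C₂ n) + C₃ (n ∸ K)                   ≡⟨ cong (R₂ n + shift u C₂ n +_) split-below ⟩
      (R₂ n + shift u C₂ n) + (R₃ (n ∸ K) + shift K C₃ (n ∸ u))
        ≡⟨ interchange (R₂ n) (shift u C₂ n) (R₃ (n ∸ K)) (shift K C₃ (n ∸ u)) ⟩
      (R₂ n + R₃ (n ∸ K)) + (shift u C₂ n + shift K C₃ (n ∸ u))
        ≡⟨ cong₂ _+_ R-suc C-suc ⟨
      R₃ n + shift u C₃ n                                  ∎
      where
      open ≡-Reasoning
      K = (3 + k) ^ d
      C₂ = C.count (2 + k)
      C₃ = C.count (3 + k)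
      R₂ = R.count (2 + k)
      R₃ = R.count (3 + k)
      u≤n : u ≤ n
      u≤n = ≤-trans (^-monoˡ-≤ d (m≤m+n 2 (suc k))) K≤n
      split-below : C₃ (n ∸ K) ≡ R₃ (n ∸ K) + shift K C₃ (n ∸ u)
      split-below = trans (rec (∸-monoʳ-< (C.0<base^d (2 + k)) K≤n) (suc k))
                          (cong (R₃ (n ∸ K) +_) (shift-comm C₃ u≤n K≤n))
      R-suc : R₃ n ≡ R₂ n + R₃ (n ∸ K)
      R-suc = trans (R.count-suc (2 + k) n) (cong (R₂ n +_) (shift-≥ R₃ K≤n))
      C-suc : shift u C₃ n ≡ shift u C₂ n + shift K C₃ (n ∸ u)
      C-suc = begin
        shift u C₃ n                         ≡⟨ shift-≥ C₃ u≤n ⟩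
        C₃ (n ∸ u)                           ≡⟨ C.count-suc (2 + k) (n ∸ u) ⟩
        C₂ (n ∸ u) + shift K C₃ (n ∸ u)      ≡⟨ cong (_+ shift K C₃ (n ∸ u)) (shift-≥ C₂ u≤n) ⟨
        shift u C₂ n + shift K C₃ (n ∸ u)    ∎

  module _ (1≤d : 1 ≤ d) where

    total-split : ∀ n → C.total n ≡ R.total n + shift u C.total n
    total-split n = begin
      C.total n                                        ≡⟨ C.count-saturated 1≤d n≤2+n ⟨
      C.count (2 + n) n                                ≡⟨ count-split n n ⟩
      R.count (2 + n) n + shift u (C.count (2 + n)) n  ≡⟨ cong₂ _+_ (R.count-saturated 1≤d n≤2+n)
                                                                    (shift-cong u (C.count (2 + n)) C.total λ _ →
                                                                      C.count-saturated 1≤d (≤-trans (m∸n≤m n u) n≤2+n)) ⟩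
      R.total n + shift u C.total n                    ∎
      where
      open ≡-Reasoning
      n≤2+n = m≤n+m n 2

    total-split-≥ : ∀ {n} → u ≤ n → C.total n ≡ R.total n + C.total (n ∸ u)
    total-split-≥ {n} u≤n = trans (total-split n) (cong (R.total n +_) (shift-≥ C.total u≤n))

    total-split-< : ∀ {n} → n < u → C.total n ≡ R.total n
    total-split-< {n} n<u = trans (total-split n) (trans (cong (R.total n +_) (shift-< C.total n<u)) (+-identityʳ _))

module Submultiplicativity (e w : ℕ) (3u≤w : 3 * 2 ^ (2 + e) ≤ w) (v≤w : 3 ^ (2 + e) ≤ w) where

  d : ℕ
  d = 2 + e

  1≤d : 1 ≤ d
  1≤d = s≤s z≤n

  open SplitOffBaseTwo d using (module C; module R; u; R-count-2)

  v : ℕ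
  v = 3 ^ d

  p r : ℕ → ℕ
  p = C.total
  r = R.total

  p-split : ∀ {n} → u ≤ n → p n ≡ r n + p (n ∸ u)
  p-split = SplitOffBaseTwo.total-split-≥ d 1≤d

  p-split-< : ∀ {n} → n < u → p n ≡ r n
  p-split-< = SplitOffBaseTwo.total-split-< d 1≤d

  p-mono : ∀ {m n} → m ≤ n → p m ≤ p n
  p-mono = C.total-mono refl 1≤d

  r-mono : ∀ {m n} → m ≤ n → r m ≤ r n
  r-mono = R.total-mono refl 1≤d

  p-pos : ∀ n → 1 ≤ p n
  p-pos = C.total-pos refl 1≤d

  r-pos : ∀ n → 1 ≤ r n
  r-pos = R.total-pos refl 1≤d

  u≤w : u ≤ w
  u≤w = ≤-trans (m≤m*n u 3) (≤-trans (≤-reflexive (*-comm u 3)) 3u≤w)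

  p-≥2 : ∀ {n} → u ≤ n → 2 ≤ p n
  p-≥2 {n} u≤n = subst (2 ≤_) (sym (p-split u≤n)) (+-mono-≤ (r-pos n) (p-pos (n ∸ u)))

  r-≥2 : ∀ {n} → v ≤ n → 2 ≤ r n
  r-≥2 {n} v≤n =
    ≤-trans (subst (2 ≤_) (sym R₃-split) (s≤s (R.count-pos refl 2 (n ∸ v)))) (R.count≤total 1≤d 3 n)
    where
    R₃-split : R.count 3 n ≡ 1 + R.count 3 (n ∸ v)
    R₃-split = trans (R.count-suc 2 n)
                     (cong₂ _+_ (R-count-2 n) (shift-≥ (R.count 3) v≤n))

  F : ℕ
  F = p w ∸ 1

  p-w≡1+F : p w ≡ suc F
  p-w≡1+F = trans (sym (m∸n+n≡m (p-pos w))) (+-comm F 1)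

  InWindow : ℕ → ℕ → Set
  InWindow j y = y < j ^ d × j ^ d ≤ w + y

  inWindow? : ∀ j y → Dec (InWindow j y)
  inWindow? j y = y <? j ^ d ×-dec j ^ d ≤? w + y

  windowSum : (ℕ → ℕ → ℕ) → ℕ → ℕ → ℕ
  windowSum f (suc (suc (suc k))) y = windowSum f (suc (suc k)) y + when (does (inWindow? (3 + k) y)) (f (3 + k) y)
  windowSum _ _                   _ = 0

  windowSum-in : ∀ f k {y} → InWindow (3 + k) y → windowSum f (3 + k) y ≡ windowSum f (2 + k) y + f (3 + k) y
  windowSum-in f k {y} inside =
    cong (λ b → windowSum f (2 + k) y + when b (f (3 + k) y)) (dec-true (inWindow? (3 + k) y) inside)

  windowSum-out : ∀ f k {y} → ¬ InWindow (3 + k) y → windowSum f (3 + k) y ≡ windowSum f (2 + k) y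
  windowSum-out f k {y} outside =
    trans (cong (λ b → windowSum f (2 + k) y + when b (f (3 + k) y)) (dec-false (inWindow? (3 + k) y) outside))
          (+-identityʳ _)

  windowSize : ℕ → ℕ → ℕ
  windowSize = windowSum λ _ _ → 1

  windowMass : ℕ → ℕ → ℕ
  windowMass = windowSum λ j y → R.count j (w + y ∸ j ^ d)

  -- The windowed bases 3 ≤ j ≤ k form an interval; a run records its least element a and that
  -- a + t, where t + 1 is the number of windowed bases, is still in the window.
  data WindowRun (k y : ℕ) : Set where
    empty : windowSize k y ≡ 0 → WindowRun k y
    run   : ∀ a t → windowSize k y ≡ suc t → 3 ≤ a → y < a ^ d → a + t ≤ k → (a + t) ^ d ≤ w + y →
            WindowRun k y

  windowRun : ∀ k y → WindowRun k y
  windowRun zero                y = empty refl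
  windowRun (suc zero)          y = empty refl
  windowRun (suc (suc zero))    y = empty refl
  windowRun (suc (suc (suc k))) y with inWindow? (3 + k) y | windowRun (2 + k) y
  ... | yes inside@(y<K , K≤w+y) | empty size≡0 =
    run (3 + k) 0 (trans (windowSum-in _ k inside) (cong (_+ 1) size≡0)) (m≤m+n 3 k) y<K
        (≤-reflexive (+-identityʳ _)) (subst (λ j → j ^ d ≤ w + y) (sym (+-identityʳ _)) K≤w+y)
  ... | yes inside@(y<K , K≤w+y) | run a t size≡1+t 3≤a y<a^d a+t≤k _ =
    run a (suc t) (trans (windowSum-in _ k inside) (trans (cong (_+ 1) size≡1+t) (cong suc (+-comm t 1))))
        3≤a y<a^d a+1+t≤3+k (≤-trans (^-monoˡ-≤ d a+1+t≤3+k) K≤w+y)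
    where
    a+1+t≤3+k : a + suc t ≤ 3 + k
    a+1+t≤3+k = subst (_≤ 3 + k) (sym (+-suc a t)) (s≤s a+t≤k)
  ... | no outside | empty size≡0 = empty (trans (windowSum-out _ k outside) size≡0)
  ... | no outside | run a t size≡1+t 3≤a y<a^d a+t≤k top =
    run a t (trans (windowSum-out _ k outside) size≡1+t) 3≤a y<a^d (≤-trans a+t≤k (n≤1+n _)) top

  long-run-fits : ∀ {a t y} → 3 ≤ a → 2 ≤ t → y < a ^ d → (a + t) ^ d ≤ w + y → (t + 2) * u ≤ w
  long-run-fits {a} {t} {y} 3≤a 2≤t y<a^d top = +-cancelʳ-≤ (a ^ d) ((t + 2) * u) w (begin
    (t + 2) * u + a ^ d  ≡⟨ +-comm ((t + 2) * u) (a ^ d) ⟩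
    a ^ d + (t + 2) * u  ≤⟨ power-gap-wide e 3≤a 2≤t ⟩
    (a + t) ^ d          ≤⟨ top ⟩
    w + y                ≤⟨ +-monoʳ-≤ w (<⇒≤ y<a^d) ⟩
    w + a ^ d            ∎)
    where open ≤-Reasoning

  windowSize-fits : ∀ k y → suc (windowSize k y) * u ≤ w
  windowSize-fits k y with windowRun k y
  ... | empty size≡0 = subst (λ s → suc s * u ≤ w) (sym size≡0) (≤-trans (*-monoˡ-≤ u (s≤s (z≤n {2}))) 3u≤w)
  ... | run a t size≡1+t 3≤a y<a^d _ top = subst (λ s → suc s * u ≤ w) (sym size≡1+t) fits
    where
    fits : suc (suc t) * u ≤ w
    fits with t <? 2
    ... | yes t<2 = ≤-trans (*-monoˡ-≤ u (s≤s t<2)) 3u≤w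
    ... | no  t≮2 = subst (λ s → s * u ≤ w) (+-comm t 2) (long-run-fits 3≤a (≮⇒≥ t≮2) y<a^d top)

  Clearance : ℕ → ℕ → Set
  Clearance ε y = ∀ {j} → 3 ≤ j → y < j ^ d → ε * u + y ≤ j ^ d

  windowSize-gap : ∀ {ε y} → Clearance ε y → ∀ k → y < (3 + k) ^ d →
                   (windowSize (2 + k) y + ε) * u + y ≤ (3 + k) ^ d
  windowSize-gap {ε} {y} clear k y<K with windowRun (2 + k) y
  ... | empty size≡0 = subst (λ s → (s + ε) * u + y ≤ (3 + k) ^ d) (sym size≡0) (clear (m≤m+n 3 k) y<K)
  ... | run a t size≡1+t 3≤a y<a^d a+t≤2+k _ =
    subst (λ s → (s + ε) * u + y ≤ (3 + k) ^ d) (sym size≡1+t) (begin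
      (suc t + ε) * u + y      ≡⟨ regroup t ε u y ⟩
      suc t * u + (ε * u + y)  ≤⟨ +-monoʳ-≤ (suc t * u) (clear 3≤a y<a^d) ⟩
      suc t * u + a ^ d        ≡⟨ +-comm (suc t * u) (a ^ d) ⟩
      a ^ d + suc t * u        ≤⟨ power-gap e (suc t) (≤-trans (n≤1+n 2) 3≤a) ⟩
      (a + suc t) ^ d          ≤⟨ ^-monoˡ-≤ d (subst (_≤ 3 + k) (sym (+-suc a t)) (s≤s a+t≤2+k)) ⟩
      (3 + k) ^ d              ∎)
    where
    open ≤-Reasoning
    regroup : ∀ t ε u y → (suc t + ε) * u + y ≡ suc t * u + (ε * u + y)
    regroup = solve 4 (λ t ε u y → (con 1 :+ t :+ ε) :* u :+ y := (con 1 :+ t) :* u :+ (ε :* u :+ y)) refl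

  -- The windowed bases, taken in order, leave at most w ∸ (i + ε)·u (windowSize-gap), so the terms
  -- are dominated by the r-summands of the expansion p x = r x + p (x ∸ u) at x = w ∸ ε·u.
  windowMass-telescope : ∀ {ε y} → ε ≤ 1 → Clearance ε y → ∀ k →
                         windowMass k y + p (w ∸ (windowSize k y + ε) * u) ≤ p (w ∸ ε * u)
  windowMass-telescope ε≤1 clear zero             = ≤-refl
  windowMass-telescope ε≤1 clear (suc zero)       = ≤-refl
  windowMass-telescope ε≤1 clear (suc (suc zero)) = ≤-refl
  windowMass-telescope {ε} {y} ε≤1 clear (suc (suc (suc k)))
    with inWindow? (3 + k) y | windowMass-telescope ε≤1 clear (suc (suc k))
  ... | no outside | IH =
    subst₂ (λ M s → M + p (w ∸ (s + ε) * u) ≤ p (w ∸ ε * u))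
           (sym (windowSum-out _ k outside)) (sym (windowSum-out _ k outside))
           IH
  ... | yes inside | IH = begin
    windowMass (3 + k) y + p (w ∸ (windowSize (3 + k) y + ε) * u)
      ≡⟨ cong₂ (λ M s → M + p (w ∸ (s + ε) * u)) (windowSum-in _ k inside) (windowSum-in _ k inside) ⟩
    M + R.count (3 + k) (w + y ∸ K) + p (w ∸ (s + 1 + ε) * u)
      ≡⟨ cong (λ x → M + R.count (3 + k) (w + y ∸ K) + p x) A∸u≡ ⟨
    M + R.count (3 + k) (w + y ∸ K) + p (A ∸ u)
      ≤⟨ +-monoˡ-≤ (p (A ∸ u)) (+-monoʳ-≤ M largest-part-removed≤r) ⟩
    M + r A + p (A ∸ u)
      ≡⟨ +-assoc M (r A) (p (A ∸ u)) ⟩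
    M + (r A + p (A ∸ u))
      ≡⟨ cong (M +_) (p-split u≤A) ⟨
    M + p A
      ≤⟨ IH ⟩
    p (w ∸ ε * u) ∎
    where
    open ≤-Reasoning
    K = (3 + k) ^ d
    y<K = proj₁ inside
    M = windowMass (2 + k) y
    s = windowSize (2 + k) y
    A = w ∸ (s + ε) * u
    u≤A : u ≤ A
    u≤A = m+n≤o⇒m≤o∸n u (begin
      u + (s + ε) * u       ≤⟨ *-monoˡ-≤ u (s≤s (+-monoʳ-≤ s ε≤1)) ⟩
      suc (s + 1) * u       ≡⟨ cong (λ x → suc x * u) (windowSum-in _ k inside) ⟨
      suc (windowSize (3 + k) y) * u ≤⟨ windowSize-fits (3 + k) y ⟩
      w                     ∎)
    A∸u≡ : A ∸ u ≡ w ∸ (s + 1 + ε) * u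
    A∸u≡ = trans (∸-+-assoc w ((s + ε) * u) u) (cong (w ∸_) (one-more s ε u))
      where
      one-more : ∀ s ε u → (s + ε) * u + u ≡ (s + 1 + ε) * u
      one-more = solve 3 (λ s ε u → (s :+ ε) :* u :+ u := (s :+ con 1 :+ ε) :* u) refl
    largest-part-removed≤r : R.count (3 + k) (w + y ∸ K) ≤ r A
    largest-part-removed≤r =
      ≤-trans (R.count≤total 1≤d (3 + k) (w + y ∸ K)) (r-mono (m+n∸o≤m∸k w (windowSize-gap clear k y<K)))

  windowMass-bound : ∀ k y → windowMass k y + 1 ≤ F
  windowMass-bound k y = ≤-pred (subst₂ _≤_ (+-suc M 1) p-w≡1+F (begin
    M + 2                       ≤⟨ +-monoʳ-≤ M (p-≥2 (m+n≤o⇒m≤o∸n u fits)) ⟩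
    M + p (w ∸ (s + 0) * u)     ≤⟨ windowMass-telescope z≤n clear k ⟩
    p w                         ∎))
    where
    open ≤-Reasoning
    M = windowMass k y
    s = windowSize k y
    clear : Clearance 0 y
    clear _ = <⇒≤
    fits : u + (s + 0) * u ≤ w
    fits = subst (λ x → suc x * u ≤ w) (sym (+-identityʳ s)) (windowSize-fits k y)

  windowMass-bound-small : ∀ k y → u + y ≤ v → windowMass k y + 2 ≤ F
  windowMass-bound-small k y u+y≤v = ≤-pred (subst₂ _≤_ (+-suc M 2) p-w≡1+F (begin
    M + 3                                  ≡⟨ +-assoc M 1 2 ⟨
    M + 1 + 2                              ≤⟨ +-mono-≤ (+-monoʳ-≤ M (p-pos (w ∸ (s + 1) * u))) (r-≥2 v≤w) ⟩
    M + p (w ∸ (s + 1) * u) + r w          ≤⟨ +-monoˡ-≤ (r w) (windowMass-telescope (s≤s z≤n) clear k) ⟩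
    p (w ∸ 1 * u) + r w                    ≡⟨ cong (λ x → p (w ∸ x) + r w) (*-identityˡ u) ⟩
    p (w ∸ u) + r w                        ≡⟨ +-comm (p (w ∸ u)) (r w) ⟩
    r w + p (w ∸ u)                        ≡⟨ p-split u≤w ⟨
    p w                                    ∎))
    where
    open ≤-Reasoning
    M = windowMass k y
    s = windowSize k y
    clear : Clearance 1 y
    clear {j} 3≤j _ = subst (_≤ j ^ d) (cong (_+ y) (sym (*-identityˡ u))) (≤-trans u+y≤v (^-monoˡ-≤ d 3≤j))

  windowTerm : ℕ → ℕ → ℕ
  windowTerm j y = when (does (inWindow? j y)) (R.count j (w + y ∸ j ^ d))

  shifted-part-bound : ∀ i y → (∀ {y′} → y′ < y → R.count (suc i) (w + y′) ≤ F * R.count (suc i) y′) →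
                       shift (suc i ^ d) (R.count (suc i)) (w + y)
                         ≤ F * shift (suc i ^ d) (R.count (suc i)) y + windowTerm (suc i) y
  shifted-part-bound i y rec with suc i ^ d ≤? y
  ... | yes K≤y = begin
    shift K Rj (w + y)                      ≡⟨ shift-≥ Rj (≤-trans K≤y (m≤n+m y w)) ⟩
    Rj (w + y ∸ K)                          ≡⟨ cong Rj (+-∸-assoc w K≤y) ⟩
    Rj (w + (y ∸ K))                        ≤⟨ rec (∸-monoʳ-< (R.0<base^d i) K≤y) ⟩
    F * Rj (y ∸ K)                          ≡⟨ cong (F *_) (shift-≥ Rj K≤y) ⟨
    F * shift K Rj y                        ≤⟨ m≤m+n (F * shift K Rj y) (windowTerm (suc i) y) ⟩
    F * shift K Rj y + windowTerm (suc i) y ∎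
    where
    open ≤-Reasoning
    K = suc i ^ d
    Rj = R.count (suc i)
  ... | no K≰y = begin
    shift K Rj (w + y)                      ≤⟨ upper-part (K ≤? w + y) ⟩
    windowTerm (suc i) y                    ≡⟨ cong (_+ windowTerm (suc i) y) (*-zeroʳ F) ⟨
    F * 0 + windowTerm (suc i) y            ≡⟨ cong (λ x → F * x + windowTerm (suc i) y) (shift-< Rj (≰⇒> K≰y)) ⟨
    F * shift K Rj y + windowTerm (suc i) y ∎
    where
    open ≤-Reasoning
    K = suc i ^ d
    Rj = R.count (suc i)
    upper-part : Dec (K ≤ w + y) → shift K Rj (w + y) ≤ windowTerm (suc i) y
    upper-part (yes K≤w+y) =
      ≤-reflexive (trans (shift-≥ Rj K≤w+y) (cong (λ b → when b (Rj (w + y ∸ K)))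
                                                  (sym (dec-true (inWindow? (suc i) y) (≰⇒> K≰y , K≤w+y)))))
    upper-part (no K≰w+y)  = subst (_≤ windowTerm (suc i) y) (sym (shift-< Rj (≰⇒> K≰w+y))) z≤n

  ShiftBound : ℕ → ℕ → Set
  ShiftBound k y = R.count k (w + y) + F ≤ F * R.count k y + windowMass k y + 1

  ShiftBound⇒≤ : ∀ {k y} → ShiftBound k y → R.count k (w + y) ≤ F * R.count k y
  ShiftBound⇒≤ {k} {y} bound = +-cancelʳ-≤ F (R.count k (w + y)) (F * R.count k y) (begin
    R.count k (w + y) + F                     ≤⟨ bound ⟩
    F * R.count k y + windowMass k y + 1      ≡⟨ +-assoc (F * R.count k y) (windowMass k y) 1 ⟩
    F * R.count k y + (windowMass k y + 1)    ≤⟨ +-monoʳ-≤ (F * R.count k y) (windowMass-bound k y) ⟩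
    F * R.count k y + F                       ∎)
    where open ≤-Reasoning

  ShiftBound⇒< : ∀ {k y} → u + y ≤ v → ShiftBound k y → R.count k (w + y) + 1 ≤ F * R.count k y
  ShiftBound⇒< {k} {y} u+y≤v bound = +-cancelʳ-≤ F (R.count k (w + y) + 1) (F * R.count k y) (begin
    R.count k (w + y) + 1 + F                 ≡⟨ xy∙z≈xz∙y (R.count k (w + y)) 1 F ⟩
    R.count k (w + y) + F + 1                 ≤⟨ +-monoˡ-≤ 1 bound ⟩
    F * R.count k y + windowMass k y + 1 + 1  ≡⟨ regroup (F * R.count k y) (windowMass k y) ⟩
    F * R.count k y + (windowMass k y + 2)    ≤⟨ +-monoʳ-≤ (F * R.count k y) (windowMass-bound-small k y u+y≤v) ⟩
    F * R.count k y + F                       ∎)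
    where
    open ≤-Reasoning
    regroup : ∀ a b → a + b + 1 + 1 ≡ a + (b + 2)
    regroup = solve 2 (λ a b → a :+ b :+ con 1 :+ con 1 := a :+ (b :+ con 2)) refl

  shiftBound : ∀ k y → ShiftBound (2 + k) y
  shiftBound zero y = ≤-reflexive (begin
    R.count 2 (w + y) + F        ≡⟨ cong (_+ F) (R-count-2 (w + y)) ⟩
    1 + F                        ≡⟨ +-comm 1 F ⟩
    F + 1                        ≡⟨ cong (_+ 1) (trans (+-identityʳ (F * 1)) (*-identityʳ F)) ⟨
    F * 1 + 0 + 1                ≡⟨ cong (λ x → F * x + 0 + 1) (R-count-2 y) ⟨
    F * R.count 2 y + 0 + 1      ∎)
    where open ≡-Reasoning
  shiftBound (suc k) = <-rec _ step
    where
    step : ∀ y → (∀ {y′} → y′ < y → ShiftBound (3 + k) y′) → ShiftBound (3 + k) y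
    step y rec = begin
      R₃ (w + y) + F                                       ≡⟨ cong (_+ F) (R.count-suc (2 + k) (w + y)) ⟩
      R₂ (w + y) + shift K R₃ (w + y) + F                  ≡⟨ xy∙z≈xz∙y (R₂ (w + y)) (shift K R₃ (w + y)) F ⟩
      R₂ (w + y) + F + shift K R₃ (w + y)                  ≤⟨ +-mono-≤ (shiftBound k y) (shifted-part-bound (2 + k) y
                                                                (λ y′<y → ShiftBound⇒≤ (rec y′<y))) ⟩
      F * R₂ y + windowMass (2 + k) y + 1 + (F * shift K R₃ y + windowTerm (3 + k) y)
        ≡⟨ regroup F (R₂ y) (shift K R₃ y) (windowMass (2 + k) y) (windowTerm (3 + k) y) ⟩
      F * (R₂ y + shift K R₃ y) + windowMass (3 + k) y + 1 ≡⟨ cong (λ x → F * x + windowMass (3 + k) y + 1)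
                                                                   (R.count-suc (2 + k) y) ⟨
      F * R₃ y + windowMass (3 + k) y + 1                  ∎
      where
      open ≤-Reasoning
      K = (3 + k) ^ d
      R₂ = R.count (2 + k)
      R₃ = R.count (3 + k)
      regroup : ∀ f a b m t → f * a + m + 1 + (f * b + t) ≡ f * (a + b) + (m + t) + 1
      regroup = solve 5 (λ f a b m t → f :* a :+ m :+ con 1 :+ (f :* b :+ t) := f :* (a :+ b) :+ (m :+ t) :+ con 1) refl

  r-saturated : ∀ {k} n → n ≤ k → R.count k n ≡ r n
  r-saturated n = R.count-saturated 1≤d

  r-shift-bound : ∀ y → r (w + y) ≤ F * r y
  r-shift-bound y = subst₂ (λ a b → a ≤ F * b) (r-saturated (w + y) (m≤n+m (w + y) 2))
                           (r-saturated y (≤-trans (m≤n+m y w) (m≤n+m (w + y) 2)))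
                           (ShiftBound⇒≤ {2 + (w + y)} (shiftBound (w + y) y))

  r-shift-bound-< : ∀ y → y < u → r (w + y) + 1 ≤ F * r y
  r-shift-bound-< y y<u = subst₂ (λ a b → a + 1 ≤ F * b) (r-saturated (w + y) (m≤n+m (w + y) 2))
                                 (r-saturated y (≤-trans (m≤n+m y w) (m≤n+m (w + y) 2)))
                                 (ShiftBound⇒< {2 + (w + y)} u+y≤v (shiftBound (w + y) y))
    where
    u+y≤v : u + y ≤ v
    u+y≤v = ≤-trans (+-monoʳ-≤ u (<⇒≤ y<u))
                    (≤-trans (≤-reflexive (cong (u +_) (sym (+-identityʳ u)))) (scaled-2^≤3^ 2 2 e (m≤m+n 8 1)))

  p-shift-bound : ∀ z → p (w + z) + 1 ≤ F * p z + p (w ∸ 1)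
  p-shift-bound = <-rec _ step
    where
    step : ∀ z → (∀ {z′} → z′ < z → p (w + z′) + 1 ≤ F * p z′ + p (w ∸ 1)) →
           p (w + z) + 1 ≤ F * p z + p (w ∸ 1)
    step z rec with u ≤? z
    ... | no u≰z = begin
      p (w + z) + 1                  ≡⟨ cong (_+ 1) (p-split (≤-trans u≤w (m≤m+n w z))) ⟩
      r (w + z) + p (w + z ∸ u) + 1  ≡⟨ xy∙z≈xz∙y (r (w + z)) (p (w + z ∸ u)) 1 ⟩
      r (w + z) + 1 + p (w + z ∸ u)  ≤⟨ +-mono-≤ (r-shift-bound-< z z<u) (p-mono (m+n∸o≤m∸k w z<u)) ⟩
      F * r z + p (w ∸ 1)            ≡⟨ cong (λ x → F * x + p (w ∸ 1)) (p-split-< z<u) ⟨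
      F * p z + p (w ∸ 1)            ∎
      where
      open ≤-Reasoning
      z<u = ≰⇒> u≰z
    ... | yes u≤z = begin
      p (w + z) + 1                          ≡⟨ cong (_+ 1) (p-split (≤-trans u≤z (m≤n+m z w))) ⟩
      r (w + z) + p (w + z ∸ u) + 1          ≡⟨ +-assoc (r (w + z)) (p (w + z ∸ u)) 1 ⟩
      r (w + z) + (p (w + z ∸ u) + 1)        ≡⟨ cong (λ x → r (w + z) + (p x + 1)) (+-∸-assoc w u≤z) ⟩
      r (w + z) + (p (w + (z ∸ u)) + 1)      ≤⟨ +-mono-≤ (r-shift-bound z) (rec (∸-monoʳ-< (m^n>0 2 d) u≤z)) ⟩
      F * r z + (F * p (z ∸ u) + p (w ∸ 1))  ≡⟨ regroup F (r z) (p (z ∸ u)) (p (w ∸ 1)) ⟩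
      F * (r z + p (z ∸ u)) + p (w ∸ 1)      ≡⟨ cong (λ x → F * x + p (w ∸ 1)) (p-split u≤z) ⟨
      F * p z + p (w ∸ 1)                    ∎
      where
      open ≤-Reasoning
      regroup : ∀ f a b c → f * a + (f * b + c) ≡ f * (a + b) + c
      regroup = solve 4 (λ f a b c → f :* a :+ (f :* b :+ c) := f :* (a :+ b) :+ c) refl

  p-submultiplicative : ∀ {z} → w ≤ z → p (w + z) < p w * p z
  p-submultiplicative {z} w≤z = begin-strict
    p (w + z)            <⟨ m<m+n (p (w + z)) (s≤s z≤n) ⟩
    p (w + z) + 1        ≤⟨ p-shift-bound z ⟩
    F * p z + p (w ∸ 1)  ≤⟨ +-monoʳ-≤ (F * p z) (p-mono (≤-trans (m∸n≤m w 1) w≤z)) ⟩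
    F * p z + p z        ≡⟨ +-comm (F * p z) (p z) ⟩
    suc F * p z          ≡⟨ cong (_* p z) p-w≡1+F ⟨
    p w * p z            ∎
    where open ≤-Reasoning

pA-submultiplicative : ∀ e {w z} → 3 * 2 ^ (2 + e) ≤ w → 3 ^ (2 + e) ≤ w → w ≤ z →
                       pA (2 + e) (w + z) < pA (2 + e) w * pA (2 + e) z
pA-submultiplicative e {w} {z} 3u≤w v≤w w≤z =
  subst₂ _<_ (sym (pA≡total (2 + e) (w + z))) (sym (cong₂ _*_ (pA≡total (2 + e) w) (pA≡total (2 + e) z)))
         (Submultiplicativity.p-submultiplicative e w 3u≤w v≤w w≤z)

pA-submultiplicative-both : ∀ e {w z} → 3 * 2 ^ (2 + e) ≤ w → 3 ^ (2 + e) ≤ w →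
                                      3 * 2 ^ (2 + e) ≤ z → 3 ^ (2 + e) ≤ z →
                            pA (2 + e) (w + z) < pA (2 + e) w * pA (2 + e) z
pA-submultiplicative-both e {w} {z} 3u≤w v≤w 3u≤z v≤z with ≤-total w z
... | inj₁ w≤z = pA-submultiplicative e 3u≤w v≤w w≤z
... | inj₂ z≤w = subst₂ _<_ (cong (pA (2 + e)) (+-comm z w)) (*-comm (pA (2 + e) z) (pA (2 + e) w))
                        (pA-submultiplicative e 3u≤z v≤z z≤w)

theorem5p2 : ((d w z : ℕ) → 3 ≤ d → 3 ^ d ≤ w → 3 ^ d ≤ z →
                pA d (w + z) < pA d w * pA d z)
           × ((w z : ℕ) → 12 ≤ w → 12 ≤ z →
                pA 2 (w + z) < pA 2 w * pA 2 z)
theorem5p2 = cubes-and-beyond , squares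
  where
  cubes-and-beyond : (d w z : ℕ) → 3 ≤ d → 3 ^ d ≤ w → 3 ^ d ≤ z → pA d (w + z) < pA d w * pA d z
  cubes-and-beyond _ w z (s≤s (s≤s (s≤s (z≤n {n = e})))) v≤w v≤z =
    pA-submultiplicative-both (suc e) (≤-trans 3u≤v v≤w) v≤w (≤-trans 3u≤v v≤z) v≤z
    where
    3u≤v : 3 * 2 ^ (3 + e) ≤ 3 ^ (3 + e)
    3u≤v = scaled-2^≤3^ 3 3 e (m≤m+n 24 3)
  squares : (w z : ℕ) → 12 ≤ w → 12 ≤ z → pA 2 (w + z) < pA 2 w * pA 2 z
  squares w z 12≤w 12≤z =
    pA-submultiplicative-both 0 12≤w (≤-trans 9≤12 12≤w) 12≤z (≤-trans 9≤12 12≤z)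
    where
    9≤12 : 9 ≤ 12
    9≤12 = m≤m+n 9 3
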